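{- Let $\mathcal{P}$ be a finite poset containing two incomparable elements $a,b\in\mathcal{P}$ such that $a$ and $b$ are both smaller than every element of $\mathcal{P}\setminus\{a,b\}$. Then for every $n\in\mathbb{N}$, $\mathrm{sat}^{*}(n,\mathcal{P})\geq n+1$.
   Context: For $n\in\mathbb{N}$, $[n]=\{1,\dots,n\}$ and $2^{[n]}$ is the family of all subsets of $[n]$. For posets $\mathcal{P}$ and $\mathcal{Q}$, $\mathcal{Q}$ contains an induced copy of $\mathcal{P}$ if there is an injective map $f:\mathcal{P}\to\mathcal{Q}$ with $f(x)\preceq_{\mathcal{Q}}f(y)$ if and only if $x\preceq_{\mathcal{P}}y$. A family $\mathcal{F}\subseteq 2^{[n]}$ is induced $\mathcal{P}$-saturated if $(\mathcal{F},\subseteq)$ contains no induced copy of $\mathcal{P}$, but for every $F\in 2^{[n]}\setminus\mathcal{F}$ the poset $(\mathcal{F}\cup\{F\},\subseteq)$ contains an induced copy of $\mathcal{P}$. $\mathrm{sat}^{*}(n,\mathcal{P})$ denotes the minimum size of an induced $\mathcal{P}$-saturated family $\mathcal{F}\subseteq 2^{[n]}$. -}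

module Defs where

open import Level using (0ℓ)
open import Data.Nat using (ℕ)
open import Data.Fin using (Fin)
open import Data.Fin.Subset using (Subset; _⊆_)
open import Data.List using (List; _∷_)
open import Data.List.Membership.Propositional using (_∈_; _∉_)
open import Data.List.Relation.Unary.Unique.Propositional using (Unique)
open import Data.Product using (Σ; _×_)
open import Function.Bundles using (_⇔_)
open import Relation.Binary using (Rel; IsPartialOrder)
open import Relation.Binary.PropositionalEquality using (_≡_)
open import Relation.Nullary using (¬_)

-- A finite poset: its ground set is Fin size (every finite poset is
-- isomorphic to one of this form).
record FinPoset : Set₁ where
  field
    size : ℕ
    _≼_ : Rel (Fin size) 0ℓ
    isPartialOrder : IsPartialOrder _≡_ _≼_

-- A family F ⊆ 2^[n] is represented by a duplicate-free list of subsets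
-- of [n] (Subset n = characteristic vectors over Fin n); its size is the
-- length of the list.

InducedCopy : (P : FinPoset) {n : ℕ} → List (Subset n) → Set
InducedCopy P {n} F =
  Σ (Fin size → Subset n) λ f →
      (∀ x y → f x ≡ f y → x ≡ y)
    × (∀ x → f x ∈ F)
    × (∀ x y → (f x ⊆ f y) ⇔ (x ≼ y))
  where open FinPoset P

InducedSaturated : (P : FinPoset) {n : ℕ} → List (Subset n) → Set
InducedSaturated P {n} F =
    Unique F
  × ¬ InducedCopy P F
  × (∀ (G : Subset n) → G ∉ F → InducedCopy P (G ∷ F))

-- An induced P-saturated family F contains ∅: otherwise ∅ would be the image of some
-- element of P in a copy, and that element would be a least element, which P lacks.
-- Moreover, for every coordinate i, F contains a pair A, A ∪ {i} with i ∉ A. Start with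
-- A = ∅; if A ∪ {i} ∉ F, saturation yields a copy of P using A ∪ {i}. It cannot be the
-- image of an element of P ∖ {a, b}: the images of a and b would then be incomparable
-- subsets of A ∪ {i}, which either lie under a copy of P ∖ {a, b} inside F or are
-- subsets of a singleton. So it is the image of a or b, and the image B of the other
-- one either completes a copy of P inside F together with A, or strictly contains A and
-- takes its place. Finally, a family with a cube edge in every direction has at least
-- n + 1 members: deleting the first coordinate identifies the two ends of the edge in
-- that direction and keeps edges in all other directions.
module Submission where

open import Defs
open import Data.Bool.Properties using () renaming (_≟_ to _≟ᵇ_)
open import Data.Empty using (⊥-elim)
open import Data.Fin using (Fin; zero; suc)
open import Data.Fin.Properties using (any?) renaming (_≟_ to _≟ᶠ_)
open import Data.Fin.Subset using (Subset; _⊆_; _⊂_; _⊃_; ⊥; ⁅_⁆; _∪_; ∣_∣)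
  renaming (_∈_ to _∈ˢ_; _∉_ to _∉ˢ_)
open import Data.Fin.Subset.Properties
  using (⊆-reflexive; ⊆-trans; ⊥⊆; _⊆?_; p⊆p∪q; ∉⊥; x∈⁅x⁆; x∈⁅y⁆⇒x≡y; x∈p∪q⁺;
         x∈p∪q⁻; ∪-identityˡ; ∪-identityʳ; ∣p∣≤n; p⊂q⇒∣p∣<∣q∣)
  renaming (_∈?_ to _∈ˢ?_)
open import Data.List using (List; []; _∷_; length; map; deduplicate)
open import Data.List.Membership.Propositional using (_∈_; _∉_; _─_)
open import Data.List.Membership.Propositional.Properties
  using (∈-map⁺; ∈-map⁻; ∈-deduplicate⁺; ∈-deduplicate⁻)
open import Data.List.Properties using (length-map; length-removeAt′)
open import Data.List.Relation.Unary.All as All using ()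
open import Data.List.Relation.Unary.AllPairs using (_∷_)
open import Data.List.Relation.Unary.Any using (here; there)
open import Data.List.Relation.Unary.Unique.Propositional using (Unique)
open import Data.List.Relation.Unary.Unique.DecPropositional.Properties
  using (deduplicate-!)
open import Data.Nat using (ℕ; zero; suc; _≤_; _<_; _∸_; z≤n; s≤s)
open import Data.Nat.Induction using (<-wellFounded)
open import Data.Nat.Properties using (∸-monoʳ-<; module ≤-Reasoning)
open import Data.Product using (Σ; ∃-syntax; _×_; _,_; proj₁; proj₂)
open import Data.Sum using (_⊎_; inj₁; inj₂; [_,_]′)
open import Data.Vec using (tail; _[_]=_) renaming (_∷_ to _∷ᵛ_)
open import Data.Vec.Properties using (≡-dec)
open import Function using (_∘_)
open import Function.Bundles using (_⇔_; mk⇔; Equivalence)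
open import Induction.WellFounded using (WellFounded; Acc; acc; module Subrelation)
open import Relation.Binary using (IsPartialOrder; DecidableEquality)
import Relation.Binary.Construct.On as On
open import Relation.Binary.PropositionalEquality
  using (_≡_; _≢_; refl; sym; trans; cong; subst; ≢-sym)
open import Relation.Nullary using (¬_; Dec; yes; no)
open import Relation.Nullary.Decidable using (decidable-stable; ¬?; _×-dec_)

open Equivalence using (to; from)

module _ {A : Set} where

  ∈-─⁺ : ∀ {x y} {xs : List A} (x∈xs : x ∈ xs) → y ∈ xs → y ≢ x → y ∈ xs ─ x∈xs
  ∈-─⁺ (here refl) (here refl) y≢x    = ⊥-elim (y≢x refl)
  ∈-─⁺ (here refl) (there y∈xs) _     = y∈xs
  ∈-─⁺ (there _) (here refl) _        = here refl
  ∈-─⁺ (there x∈xs) (there y∈xs) y≢x  = there (∈-─⁺ x∈xs y∈xs y≢x)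

  Unique-⊆⇒length≤ : ∀ {xs ys : List A} → Unique xs → (∀ {y} → y ∈ xs → y ∈ ys) →
                     length xs ≤ length ys
  Unique-⊆⇒length≤ {[]}     _              _     = z≤n
  Unique-⊆⇒length≤ {x ∷ xs} {ys} (x∉xs ∷ !xs) xs⊆ys = begin
    suc (length xs)          ≤⟨ s≤s (Unique-⊆⇒length≤ !xs xs⊆ys─x) ⟩
    suc (length (ys ─ x∈ys)) ≡⟨ length-removeAt′ ys _ ⟨
    length ys                ∎
    where
    open ≤-Reasoning
    x∈ys = xs⊆ys (here refl)
    xs⊆ys─x : ∀ {y} → y ∈ xs → y ∈ ys ─ x∈ys
    xs⊆ys─x y∈xs = ∈-─⁺ x∈ys (xs⊆ys (there y∈xs)) (≢-sym (All.lookup x∉xs y∈xs))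

module _ {n : ℕ} where

  _≟ˢ_ : DecidableEquality (Subset n)
  _≟ˢ_ = ≡-dec _≟ᵇ_

  ⊈⇒∃∉ : {p q : Subset n} → ¬ p ⊆ q → ∃[ x ] x ∈ˢ p × x ∉ˢ q
  ⊈⇒∃∉ {p} {q} p⊈q with any? (λ x → x ∈ˢ? p ×-dec ¬? (x ∈ˢ? q))
  ... | yes witness = witness
  ... | no none     = ⊥-elim (p⊈q λ {x} x∈p →
                        decidable-stable (x ∈ˢ? q) (λ x∉q → none (x , x∈p , x∉q)))

  i∈p∪⁅i⁆ : (p : Subset n) (i : Fin n) → i ∈ˢ p ∪ ⁅ i ⁆
  i∈p∪⁅i⁆ p i = x∈p∪q⁺ (inj₂ (x∈⁅x⁆ i))

  p∪⁅i⁆≢p : {p : Subset n} {i : Fin n} → i ∉ˢ p → p ∪ ⁅ i ⁆ ≢ p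
  p∪⁅i⁆≢p {p} {i} i∉p eq = i∉p (subst (i ∈ˢ_) eq (i∈p∪⁅i⁆ p i))

  ∪⁅⁆-least : {p q : Subset n} {i : Fin n} → p ⊆ q → i ∈ˢ q → p ∪ ⁅ i ⁆ ⊆ q
  ∪⁅⁆-least {p} {q} {i} p⊆q i∈q x∈p∪⁅i⁆ with x∈p∪q⁻ p ⁅ i ⁆ x∈p∪⁅i⁆
  ... | inj₁ x∈p   = p⊆q x∈p
  ... | inj₂ x∈⁅i⁆ = subst (_∈ˢ q) (sym (x∈⁅y⁆⇒x≡y i x∈⁅i⁆)) i∈q

  ⊆⁅⁆⇒comparable : {p q : Subset n} {i : Fin n} → p ⊆ ⁅ i ⁆ → q ⊆ ⁅ i ⁆ → p ⊆ q ⊎ q ⊆ p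
  ⊆⁅⁆⇒comparable {p} {q} {i} p⊆⁅i⁆ q⊆⁅i⁆ with i ∈ˢ? p
  ... | yes i∈p =
    inj₂ λ x∈q → subst (_∈ˢ p) (sym (x∈⁅y⁆⇒x≡y i (q⊆⁅i⁆ x∈q))) i∈p
  ... | no  i∉p =
    inj₁ λ x∈p → ⊥-elim (i∉p (subst (_∈ˢ p) (x∈⁅y⁆⇒x≡y i (p⊆⁅i⁆ x∈p)) x∈p))

  ⊃-wellFounded : WellFounded (_⊃_ {n})
  ⊃-wellFounded = Subrelation.wellFounded ⊂⇒∸-decreasing
                    (On.wellFounded (λ p → n ∸ ∣ p ∣) <-wellFounded)
    where
    ⊂⇒∸-decreasing : ∀ {q p : Subset n} → q ⊃ p → n ∸ ∣ q ∣ < n ∸ ∣ p ∣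
    ⊂⇒∸-decreasing {q} p⊂q = ∸-monoʳ-< (p⊂q⇒∣p∣<∣q∣ p⊂q) (∣p∣≤n q)

tail-∪⁅zero⁆ : ∀ {n} (p : Subset (suc n)) → tail (p ∪ ⁅ zero ⁆) ≡ tail p
tail-∪⁅zero⁆ (_ ∷ᵛ p) = ∪-identityʳ p

CubeEdge : ∀ {n} → List (Subset n) → Fin n → Set
CubeEdge {n} L i = ∃[ A ] A ∈ L × i ∉ˢ A × A ∪ ⁅ i ⁆ ∈ L

CubeEdge-mono : ∀ {n} {L M : List (Subset n)} {i} → (∀ {A} → A ∈ L → A ∈ M) →
                CubeEdge L i → CubeEdge M i
CubeEdge-mono L⊆M (A , A∈L , i∉A , A⁺∈L) = A , L⊆M A∈L , i∉A , L⊆M A⁺∈L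

CubeEdge-tail : ∀ {n} {L : List (Subset (suc n))} {i} → CubeEdge L (suc i) →
                CubeEdge (map tail L) i
CubeEdge-tail (_ ∷ᵛ A , A∈L , i∉A , A⁺∈L) =
  A , ∈-map⁺ tail A∈L , i∉A ∘ _[_]=_.there , ∈-map⁺ tail A⁺∈L

cubeEdges⇒suc-n≤length : ∀ n (L : List (Subset n)) → Unique L → ∃[ A ] A ∈ L →
                         (∀ i → CubeEdge L i) → suc n ≤ length L
cubeEdges⇒suc-n≤length zero    []      _  (_ , ()) _
cubeEdges⇒suc-n≤length zero    (_ ∷ _) _  _        _ = s≤s z≤n
cubeEdges⇒suc-n≤length (suc n) L       !L _        edges
  with A , A∈L , 0∉A , A⁺∈L ← edges zero = begin
    suc (suc n)                       ≤⟨ s≤s (cubeEdges⇒suc-n≤length n L′ !L′ L′-∋ L′-edges) ⟩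
    suc (length L′)                   ≤⟨ s≤s (Unique-⊆⇒length≤ !L′ L′⊆) ⟩
    suc (length (map tail (L ─ A∈L))) ≡⟨ cong suc (length-map tail (L ─ A∈L)) ⟩
    suc (length (L ─ A∈L))            ≡⟨ length-removeAt′ L _ ⟨
    length L                          ∎
  where
  open ≤-Reasoning
  L′ = deduplicate _≟ˢ_ (map tail L)
  !L′ = deduplicate-! _≟ˢ_ (map tail L)
  L′-∋ = tail A , ∈-deduplicate⁺ _≟ˢ_ (∈-map⁺ tail A∈L)
  L′-edges = λ i → CubeEdge-mono (∈-deduplicate⁺ _≟ˢ_) (CubeEdge-tail (edges (suc i)))
  -- A and A ∪ ⁅ zero ⁆ have the same tail, so removing A from L loses no tail.
  L′⊆ : ∀ {y} → y ∈ L′ → y ∈ map tail (L ─ A∈L)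
  L′⊆ y∈L′ with ∈-map⁻ tail (∈-deduplicate⁻ _≟ˢ_ (map tail L) y∈L′)
  ... | B , B∈L , refl with B ≟ˢ A
  ... | no  B≢A = ∈-map⁺ tail (∈-─⁺ A∈L B∈L B≢A)
  ... | yes refl = subst (_∈ map tail (L ─ A∈L)) (tail-∪⁅zero⁆ A)
                     (∈-map⁺ tail (∈-─⁺ A∈L A⁺∈L (p∪⁅i⁆≢p 0∉A)))

module TwoMinimal (P : FinPoset) (a b : Fin (FinPoset.size P))
  (a⋠b : ¬ FinPoset._≼_ P a b) (b⋠a : ¬ FinPoset._≼_ P b a)
  (a,b≼rest : ∀ c → c ≢ a → c ≢ b → FinPoset._≼_ P a c × FinPoset._≼_ P b c)
  where

  open FinPoset P
  open IsPartialOrder isPartialOrder using (antisym) renaming (refl to ≼-refl)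

  Upper : Fin size → Set
  Upper u = u ≢ a × u ≢ b

  a≼upper : ∀ {u} → Upper u → a ≼ u
  a≼upper (u≢a , u≢b) = proj₁ (a,b≼rest _ u≢a u≢b)

  b≼upper : ∀ {u} → Upper u → b ≼ u
  b≼upper (u≢a , u≢b) = proj₂ (a,b≼rest _ u≢a u≢b)

  upper⋠a : ∀ {u} → Upper u → ¬ u ≼ a
  upper⋠a up u≼a = proj₁ up (antisym u≼a (a≼upper up))

  upper⋠b : ∀ {u} → Upper u → ¬ u ≼ b
  upper⋠b up u≼b = proj₂ up (antisym u≼b (b≼upper up))

  data Role (x : Fin size) : Set where
    is-a  : x ≡ a → Role x
    is-b  : x ≡ b → Role x
    upper : Upper x → Role x

  role : ∀ x → Role x
  role x with x ≟ᶠ a | x ≟ᶠ b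
  ... | yes x≡a | _       = is-a x≡a
  ... | no  x≢a | yes x≡b = is-b x≡b
  ... | no  x≢a | no  x≢b = upper (x≢a , x≢b)

  no-least : ∀ z → ¬ (∀ x → z ≼ x)
  no-least z z≼ with role z
  ... | is-a refl = a⋠b (z≼ b)
  ... | is-b refl = b⋠a (z≼ a)
  ... | upper up  = upper⋠a up (z≼ a)

  IsMinimalPair : Fin size → Fin size → Set
  IsMinimalPair z w = ¬ z ≼ w × ¬ w ≼ z × (∀ {u} → Upper u → z ≼ u × w ≼ u)

  upper-or-minimalPair : ∀ z → Upper z ⊎ ∃[ w ] IsMinimalPair z w
  upper-or-minimalPair z with role z
  ... | is-a refl = inj₂ (b , a⋠b , b⋠a , λ up → a≼upper up , b≼upper up)
  ... | is-b refl = inj₂ (a , b⋠a , a⋠b , λ up → b≼upper up , a≼upper up)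
  ... | upper up  = inj₁ up

  ⊆⇔≼⇒injective : ∀ {n} (f : Fin size → Subset n) → (∀ x y → f x ⊆ f y ⇔ x ≼ y) →
                  ∀ x y → f x ≡ f y → x ≡ y
  ⊆⇔≼⇒injective f f-⊆⇔≼ x y fx≡fy =
    antisym (to (f-⊆⇔≼ x y) (⊆-reflexive fx≡fy))
            (to (f-⊆⇔≼ y x) (⊆-reflexive (sym fx≡fy)))

  record UpperEmbedding {n} (F : List (Subset n)) : Set where
    field
      φ     : Fin size → Subset n
      φ-∈   : ∀ {u} → Upper u → φ u ∈ F
      φ-⊆⇔≼ : ∀ {u v} → Upper u → Upper v → φ u ⊆ φ v ⇔ u ≼ v

  open UpperEmbedding

  LiesUnder : ∀ {n} {F : List (Subset n)} → Subset n → UpperEmbedding F → Set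
  LiesUnder X e = ∀ {u} → Upper u → X ⊆ φ e u

  UnderUpperCopy : ∀ {n} → List (Subset n) → Subset n → Set
  UnderUpperCopy F X = Σ (UpperEmbedding F) (LiesUnder X)

  incomparable-under-upper⇒InducedCopy :
    ∀ {n} {F : List (Subset n)} {A B : Subset n} →
    A ∈ F → B ∈ F → ¬ A ⊆ B → ¬ B ⊆ A →
    (e : UpperEmbedding F) → LiesUnder A e → LiesUnder B e → InducedCopy P F
  incomparable-under-upper⇒InducedCopy {n} {F} {A} {B} A∈F B∈F A⊈B B⊈A e A≤ B≤ =
    f , ⊆⇔≼⇒injective f f-⊆⇔≼ , (λ x → g-∈ x (role x)) , f-⊆⇔≼
    where
    g : ∀ x → Role x → Subset n
    g _ (is-a _)  = A
    g _ (is-b _)  = B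
    g x (upper _) = φ e x

    f : Fin size → Subset n
    f x = g x (role x)

    g-∈ : ∀ x (r : Role x) → g x r ∈ F
    g-∈ _ (is-a _)   = A∈F
    g-∈ _ (is-b _)   = B∈F
    g-∈ _ (upper up) = φ-∈ e up

    g-⊆⇔≼ : ∀ x y (r : Role x) (s : Role y) → g x r ⊆ g y s ⇔ x ≼ y
    g-⊆⇔≼ _ _ (is-a refl) (is-a refl) = mk⇔ (λ _ → ≼-refl) (λ _ {_} x∈ → x∈)
    g-⊆⇔≼ _ _ (is-a refl) (is-b refl) = mk⇔ (⊥-elim ∘ A⊈B) (⊥-elim ∘ a⋠b)
    g-⊆⇔≼ _ _ (is-a refl) (upper v)   = mk⇔ (λ _ → a≼upper v) (λ _ {x} → A≤ v {x})
    g-⊆⇔≼ _ _ (is-b refl) (is-a refl) = mk⇔ (⊥-elim ∘ B⊈A) (⊥-elim ∘ b⋠a)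
    g-⊆⇔≼ _ _ (is-b refl) (is-b refl) = mk⇔ (λ _ → ≼-refl) (λ _ {_} x∈ → x∈)
    g-⊆⇔≼ _ _ (is-b refl) (upper v)   = mk⇔ (λ _ → b≼upper v) (λ _ {x} → B≤ v {x})
    g-⊆⇔≼ _ _ (upper u)   (is-a refl) =
      mk⇔ (λ (φu⊆A : φ e _ ⊆ A) → ⊥-elim (B⊈A (⊆-trans (B≤ u) φu⊆A)))
          (⊥-elim ∘ upper⋠a u)
    g-⊆⇔≼ _ _ (upper u)   (is-b refl) =
      mk⇔ (λ (φu⊆B : φ e _ ⊆ B) → ⊥-elim (A⊈B (⊆-trans (A≤ u) φu⊆B)))
          (⊥-elim ∘ upper⋠b u)
    g-⊆⇔≼ _ _ (upper u)   (upper v)   = φ-⊆⇔≼ e u v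

    f-⊆⇔≼ : ∀ x y → f x ⊆ f y ⇔ x ≼ y
    f-⊆⇔≼ x y = g-⊆⇔≼ x y (role x) (role y)

  module Saturated {n} {F : List (Subset n)} (sat : InducedSaturated P F) where

    open import Data.List.Membership.DecPropositional (_≟ˢ_ {n}) using (_∈?_)

    no-copy : ¬ InducedCopy P F
    no-copy = proj₁ (proj₂ sat)

    record CopyThrough (G : Subset n) : Set where
      field
        f     : Fin size → Subset n
        f-∈   : ∀ x → f x ∈ G ∷ F
        f-⊆⇔≼ : ∀ x y → f x ⊆ f y ⇔ x ≼ y
        z     : Fin size
        f-z   : f z ≡ G

      f-∈F : ∀ {x} → x ≢ z → f x ∈ F
      f-∈F {x} x≢z with f-∈ x
      ... | here fx≡G  =
        ⊥-elim (x≢z (⊆⇔≼⇒injective f f-⊆⇔≼ x z (trans fx≡G (sym f-z))))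
      ... | there fx∈F = fx∈F

      ⊆G : ∀ {x} → x ≼ z → f x ⊆ G
      ⊆G x≼z = subst (f _ ⊆_) f-z (from (f-⊆⇔≼ _ z) x≼z)

      G⊆ : ∀ {x} → z ≼ x → G ⊆ f x
      G⊆ z≼x = subst (_⊆ f _) f-z (from (f-⊆⇔≼ z _) z≼x)

      restrict : (∀ {u} → Upper u → u ≢ z) → UpperEmbedding F
      restrict z∉upper = record
        { φ = f ; φ-∈ = f-∈F ∘ z∉upper ; φ-⊆⇔≼ = λ {u} {v} _ _ → f-⊆⇔≼ u v }

    copyThrough : ∀ {G} → G ∉ F → CopyThrough G
    copyThrough {G} G∉F with proj₂ (proj₂ sat) G G∉F
    ... | f , _ , f-∈ , f-⊆⇔≼ with any? (λ z → f z ≟ˢ G)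
    ...   | yes (z , f-z) =
      record { f = f ; f-∈ = f-∈ ; f-⊆⇔≼ = f-⊆⇔≼ ; z = z ; f-z = f-z }
    ...   | no  G-unused  =
      ⊥-elim (no-copy (f , ⊆⇔≼⇒injective f f-⊆⇔≼ , f-∈F , f-⊆⇔≼))
      where
      f-∈F : ∀ x → f x ∈ F
      f-∈F x with f-∈ x
      ... | here fx≡G  = ⊥-elim (G-unused (x , fx≡G))
      ... | there fx∈F = fx∈F

    ⊥∈F : ⊥ ∈ F
    ⊥∈F with ⊥ ∈? F
    ... | yes ⊥∈F = ⊥∈F
    ... | no  ⊥∉F =
      ⊥-elim (no-least z λ x → to (f-⊆⇔≼ z x) (subst (_⊆ f x) (sym f-z) ⊥⊆))
      where open CopyThrough (copyThrough ⊥∉F)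

    upperThrough-⊥ : ∀ {G j} (c : CopyThrough G) → Upper (CopyThrough.z c) →
                     ¬ (UnderUpperCopy F G ⊎ G ≡ ⁅ j ⁆)
    upperThrough-⊥ {G} c up = [ under-copy , singleton ]′
      where
      open CopyThrough c
      fa⊆G = ⊆G (a≼upper up)
      fb⊆G = ⊆G (b≼upper up)
      fa⊈fb : ¬ f a ⊆ f b
      fa⊈fb = a⋠b ∘ to (f-⊆⇔≼ a b)
      fb⊈fa : ¬ f b ⊆ f a
      fb⊈fa = b⋠a ∘ to (f-⊆⇔≼ b a)

      under-copy : ¬ UnderUpperCopy F G
      under-copy (e , G≤) = no-copy (incomparable-under-upper⇒InducedCopy
        (f-∈F (≢-sym (proj₁ up))) (f-∈F (≢-sym (proj₂ up))) fa⊈fb fb⊈fa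
        e (λ u → ⊆-trans fa⊆G (G≤ u)) (λ u → ⊆-trans fb⊆G (G≤ u)))

      singleton : ∀ {j} → ¬ G ≡ ⁅ j ⁆
      singleton G≡⁅j⁆ = [ fa⊈fb , fb⊈fa ]′
        (⊆⁅⁆⇒comparable (subst (f a ⊆_) G≡⁅j⁆ fa⊆G) (subst (f b ⊆_) G≡⁅j⁆ fb⊆G))

    module _ (i : Fin n) where

      -- The invariant of the search for an edge in direction i; its second
      -- alternative covers the start A = ⊥.
      Admissible : Subset n → Set
      Admissible A =
        A ∈ F × i ∉ˢ A × (UnderUpperCopy F (A ∪ ⁅ i ⁆) ⊎ A ∪ ⁅ i ⁆ ≡ ⁅ i ⁆)

      minimalThrough-grows : ∀ {A} → A ∈ F → (c : CopyThrough (A ∪ ⁅ i ⁆)) →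
                             ∀ {w} → IsMinimalPair (CopyThrough.z c) w →
                             ∃[ B ] Admissible B × A ⊂ B
      minimalThrough-grows {A} A∈F c {w} (z⋠w , w⋠z , z,w≼upper) = by-cases (A ⊆? B)
        where
        open CopyThrough c
        G = A ∪ ⁅ i ⁆
        B = f w
        A⊆G : A ⊆ G
        A⊆G = p⊆p∪q ⁅ i ⁆

        upper≢z : ∀ {u} → Upper u → u ≢ z
        upper≢z up refl = w⋠z (proj₂ (z,w≼upper up))

        e = restrict upper≢z
        G≤ : LiesUnder G e
        G≤ up = G⊆ (proj₁ (z,w≼upper up))
        B≤ : LiesUnder B e
        B≤ {u} up = from (f-⊆⇔≼ w u) (proj₂ (z,w≼upper up))
        B∈F : B ∈ F
        B∈F = f-∈F λ { refl → w⋠z ≼-refl }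
        B⊈G : ¬ B ⊆ G
        B⊈G B⊆G = w⋠z (to (f-⊆⇔≼ w z) (subst (B ⊆_) (sym f-z) B⊆G))
        G⊈B : ¬ G ⊆ B
        G⊈B G⊆B = z⋠w (to (f-⊆⇔≼ z w) (subst (_⊆ B) (sym f-z) G⊆B))

        by-cases : Dec (A ⊆ B) → ∃[ B ] Admissible B × A ⊂ B
        by-cases (yes A⊆B) = B , (B∈F , i∉B , inj₁ (e , B⁺≤)) , A⊆B , B∖A-inhabited
          where
          i∉B = λ i∈B → G⊈B (∪⁅⁆-least A⊆B i∈B)
          B⁺≤ : LiesUnder (B ∪ ⁅ i ⁆) e
          B⁺≤ up = ∪⁅⁆-least (B≤ up) (G≤ up (i∈p∪⁅i⁆ A i))
          B∖A-inhabited : ∃[ x ] x ∈ˢ B × x ∉ˢ A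
          B∖A-inhabited with x , x∈B , x∉G ← ⊈⇒∃∉ B⊈G = x , x∈B , x∉G ∘ A⊆G
        by-cases (no A⊈B) = ⊥-elim (no-copy (incomparable-under-upper⇒InducedCopy
          A∈F B∈F A⊈B B⊈A e (λ up → ⊆-trans A⊆G (G≤ up)) B≤))
          where
          B⊈A : ¬ B ⊆ A
          B⊈A B⊆A = B⊈G (⊆-trans B⊆A A⊆G)

      step : ∀ {A} → Admissible A → A ∪ ⁅ i ⁆ ∈ F ⊎ ∃[ B ] Admissible B × A ⊂ B
      step {A} (A∈F , _ , under) with A ∪ ⁅ i ⁆ ∈? F
      ... | yes A⁺∈F = inj₁ A⁺∈F
      ... | no  A⁺∉F = inj₂ (through (copyThrough A⁺∉F))
        where
        through : CopyThrough (A ∪ ⁅ i ⁆) → ∃[ B ] Admissible B × A ⊂ B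
        through c = [ (λ up → ⊥-elim (upperThrough-⊥ c up under))
                    , (λ (_ , minimal) → minimalThrough-grows A∈F c minimal)
                    ]′ (upper-or-minimalPair (CopyThrough.z c))

      cubeEdge : CubeEdge F i
      cubeEdge = climb (⊃-wellFounded ⊥) (⊥∈F , ∉⊥ , inj₂ (∪-identityˡ ⁅ i ⁆))
        where
        climb : ∀ {A} → Acc _⊃_ A → Admissible A → CubeEdge F i
        climb {A} (acc larger) adm@(A∈F , i∉A , _) with step adm
        ... | inj₁ A⁺∈F             = A , A∈F , i∉A , A⁺∈F
        ... | inj₂ (B , admB , A⊂B) = climb (larger A⊂B) admB

theorem3 : (P : FinPoset) (a b : Fin (FinPoset.size P))
    → ¬ FinPoset._≼_ P a b
    → ¬ FinPoset._≼_ P b a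
    → (∀ c → c ≢ a → c ≢ b → FinPoset._≼_ P a c × FinPoset._≼_ P b c)
    → (n : ℕ) (F : List (Subset n))
    → InducedSaturated P F
    → suc n ≤ length F
theorem3 P a b a⋠b b⋠a a,b≼rest n F sat =
  cubeEdges⇒suc-n≤length n F (proj₁ sat) (⊥ , ⊥∈F) cubeEdge
  where open TwoMinimal.Saturated P a b a⋠b b⋠a a,b≼rest sat
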